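{- Let $n\ge3$, let $m,y$ be nonnegative integers, and let $x$ be any position of Exco-Nim with parameter $n$ such that $m(x)=m$ and $y(x)=y$. Let $\mathcal{L}=\{(m(x'),y(x')) : x\to x'\text{ is a legal move}\}$. Then $g(m,y)\notin\{g(m',y') : (m',y')\in\mathcal{L}\}$.
   Context: Exco-Nim with parameter $n$: positions are tuples $x=(x_0,x_1,\ldots,x_n)$ of nonnegative integers. A legal move $x\to x'$ is to a tuple $x'$ of nonnegative integers with $x'_j\le x_j$ for all $j$, $\sum_j x'_j<\sum_j x_j$, and $x'_i=x_i$ for at least one index $1\le i\le n$. For a position $x$: $m(x)=\min_{1\le i\le n}x_i$, $u(x)=\sum_{i=0}^n x_i$, $y(x)=u(x)-n\,m(x)$. For nonnegative integers $m,y$ put $u=y+nm$, $z=\binom{y+1}{2}+1$, and define $g(m,y)=u$ if $m<z$, and $g(m,y)=(z-1)+\big((m-z)\bmod(y+1)\big)$ if $m\ge z$, where $a\bmod b\in\{0,\ldots,b-1\}$. -}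

module Defs where

open import Data.Nat using (ℕ; zero; suc; _+_; _*_; _∸_; _≤_; _<_; _⊓_; _<?_)
open import Data.Nat.DivMod using (_%_)
open import Data.Nat.Combinatorics using (_C_)
open import Data.Fin using (Fin; zero; suc)
open import Data.Product using (Σ; _×_)
open import Relation.Binary.PropositionalEquality using (_≡_)
open import Relation.Nullary.Decidable using (does)
open import Data.Bool using (if_then_else_)

-- A position of Exco-Nim with parameter n: (x_0, x_1, ..., x_n), index set Fin (suc n).
Position : ℕ → Set
Position n = Fin (suc n) → ℕ

sumFin : (k : ℕ) → (Fin k → ℕ) → ℕ
sumFin zero    f = 0
sumFin (suc k) f = f zero + sumFin k (λ i → f (suc i))

minFin : (k : ℕ) → (Fin (suc k) → ℕ) → ℕ
minFin zero    f = f zero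
minFin (suc k) f = f zero ⊓ minFin k (λ i → f (suc i))

-- m(x) = min_{1 ≤ i ≤ n} x_i   (for n = suc k; indices 1..n are suc i, i : Fin n)
mOf : (k : ℕ) → Position (suc k) → ℕ
mOf k x = minFin k (λ i → x (suc i))

uOf : (n : ℕ) → Position n → ℕ
uOf n x = sumFin (suc n) x

-- y(x) = u(x) - n m(x)  (always ≥ 0, so truncated subtraction is exact)
yOf : (k : ℕ) → Position (suc k) → ℕ
yOf k x = uOf (suc k) x ∸ suc k * mOf k x

g : (n : ℕ) → ℕ → ℕ → ℕ
g n m y =
  let u = y + n * m
      z = suc y C 2 + 1
  in if does (m <? z) then u else (z ∸ 1) + ((m ∸ z) % suc y)

LegalMove : (n : ℕ) → Position n → Position n → Set
LegalMove n x x' =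
  ((j : Fin (suc n)) → x' j ≤ x j) ×
  (uOf n x' < uOf n x) ×
  Σ (Fin n) (λ i → x' (suc i) ≡ x (suc i))

module Submission where

-- Write T y = (y+1 choose 2), z(y) = T y + 1 and u = y + n·m.
-- g(m,y) is "low" (equal to u) when m < z(y); otherwise it lies in the "band"
-- [T y, T y + y] of level y, as T y plus the residue of m ∸ z(y) mod y+1, and
-- such a band value is smaller than m.
--
-- A legal move x → x' gives  u' < u  (a token is removed) and  m ≤ y' + m'
-- (some heap among x_1..x_n is kept, and each of them is at most y' + m').
-- The core lemma `g-separates` shows these two inequalities force
-- g(m,y) ≠ g(m',y'): two low values differ since u' < u; a low value and a
-- band value differ since band values lie below m; two band values have equal
-- levels (bands are disjoint), hence m' < m ≤ m' + y and their residues differ.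

open import Defs
open import Data.Nat using (ℕ; suc; zero; _+_; _*_; _∸_; _≤_; _<_; _<?_; s≤s; z<s; >-nonZero)
open import Data.Nat.Properties
open import Data.Nat.DivMod using (_%_; _/_; m≡m%n+[m/n]*n; m%n<n; m%n≤m)
open import Data.Nat.Divisibility using (_∣_; divides; >⇒∤)
open import Data.Nat.Combinatorics using (_C_; nC1≡n; nCk+nC[k+1]≡[n+1]C[k+1])
open import Data.Fin using (Fin; zero; suc)
open import Data.Product using (_×_; Σ; _,_)
open import Relation.Binary.PropositionalEquality
  using (_≡_; _≢_; refl; sym; trans; cong; cong₂; subst; subst₂; module ≡-Reasoning)
open import Relation.Binary.Definitions using (tri<; tri≈; tri>)
open import Relation.Nullary using (¬_; yes; no; contradiction)
open import Relation.Nullary.Decidable using (dec-true; dec-false)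
open import Data.Bool using (if_then_else_)

tri : ℕ → ℕ
tri y = suc y C 2

threshold : ℕ → ℕ
threshold y = tri y + 1

tri-suc : ∀ y → tri (suc y) ≡ suc y + tri y
tri-suc y = trans (sym (nCk+nC[k+1]≡[n+1]C[k+1] (suc y) 1)) (cong (_+ tri y) (nC1≡n (suc y)))

tri-mono : ∀ y d → tri y ≤ tri (d + y)
tri-mono y zero     = ≤-refl
tri-mono y (suc d)  = ≤-trans (tri-mono y d) (subst (tri (d + y) ≤_) (sym (tri-suc (d + y))) (m≤n+m _ _))

band-below-next : ∀ {y y'} → y < y' → tri y + suc y ≤ tri y'
band-below-next {y} {y'} y<y' = begin
  tri y + suc y                  ≡⟨ +-comm (tri y) (suc y) ⟩
  suc y + tri y                  ≡⟨ sym (tri-suc y) ⟩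
  tri (suc y)                    ≤⟨ tri-mono (suc y) (y' ∸ suc y) ⟩
  tri (y' ∸ suc y + suc y)       ≡⟨ cong tri (m∸n+n≡m y<y') ⟩
  tri y'                         ∎
  where open ≤-Reasoning

lower-band-below : ∀ {y y' r r'} → y < y' → r < suc y → tri y + r < tri y' + r'
lower-band-below {y} {y'} {r} {r'} y<y' r<y = begin-strict
  tri y + r       <⟨ +-monoʳ-< (tri y) r<y ⟩
  tri y + suc y   ≤⟨ band-below-next y<y' ⟩
  tri y'          ≤⟨ m≤m+n (tri y') r' ⟩
  tri y' + r'     ∎
  where open ≤-Reasoning

band-level-injective : ∀ {y y' r r'} → r < suc y → r' < suc y' →
                       tri y + r ≡ tri y' + r' → y ≡ y'
band-level-injective {y} {y'} r<y r'<y' eq with <-cmp y y'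
... | tri< y<y' _ _ = contradiction eq (<⇒≢ (lower-band-below y<y' r<y))
... | tri≈ _ y≡y' _ = y≡y'
... | tri> _ _ y'<y = contradiction (sym eq) (<⇒≢ (lower-band-below y'<y r'<y'))

equal-residues⇒∣∸ : ∀ a b d → a % suc d ≡ b % suc d → suc d ∣ a ∸ b
equal-residues⇒∣∸ a b d eq = divides (q ∸ q') (begin
  a ∸ b                                      ≡⟨ cong₂ _∸_ (m≡m%n+[m/n]*n a (suc d)) (m≡m%n+[m/n]*n b (suc d)) ⟩
  (a % suc d + q * suc d) ∸ (r' + q' * suc d) ≡⟨ cong (λ r → (r + q * suc d) ∸ (r' + q' * suc d)) eq ⟩
  (r' + q * suc d) ∸ (r' + q' * suc d)       ≡⟨ [m+n]∸[m+o]≡n∸o r' (q * suc d) (q' * suc d) ⟩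
  q * suc d ∸ q' * suc d                     ≡⟨ sym (*-distribʳ-∸ (suc d) q q') ⟩
  (q ∸ q') * suc d                           ∎)
  where
  open ≡-Reasoning
  q  = a / suc d
  q' = b / suc d
  r' = b % suc d

close-residues-differ : ∀ {a b} d → b < a → a ≤ b + d → a % suc d ≢ b % suc d
close-residues-differ {a} {b} d b<a a≤b+d eq =
  >⇒∤ {{>-nonZero (m<n⇒0<n∸m b<a)}} (s≤s gap≤d) (equal-residues⇒∣∸ a b d eq)
  where
  gap≤d : a ∸ b ≤ d
  gap≤d = subst (a ∸ b ≤_) (m+n∸m≡n b d) (∸-monoˡ-≤ b a≤b+d)

bandValue : ℕ → ℕ → ℕ
bandValue m y = tri y + (m ∸ threshold y) % suc y

g-low : ∀ n m y → m < threshold y → g n m y ≡ y + n * m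
g-low n m y m<z =
  cong (λ b → if b then y + n * m else tri y + 1 ∸ 1 + (m ∸ threshold y) % suc y)
       (dec-true (m <? threshold y) m<z)

g-band : ∀ n m y → ¬ m < threshold y → g n m y ≡ bandValue m y
g-band n m y m≮z = begin
  g n m y                                       ≡⟨ cong (λ b → if b then y + n * m else tri y + 1 ∸ 1 + r)
                                                        (dec-false (m <? threshold y) m≮z) ⟩
  tri y + 1 ∸ 1 + r                             ≡⟨ cong (_+ r) (m+n∸n≡m (tri y) 1) ⟩
  bandValue m y                                 ∎
  where
  open ≡-Reasoning
  r = (m ∸ threshold y) % suc y

bandValue<m : ∀ m y → ¬ m < threshold y → bandValue m y < m
bandValue<m m y m≮z = begin-strict
  tri y + (m ∸ threshold y) % suc y  ≤⟨ +-monoʳ-≤ (tri y) (m%n≤m (m ∸ threshold y) (suc y)) ⟩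
  tri y + (m ∸ threshold y)          <⟨ +-monoˡ-< (m ∸ threshold y) (m<m+n (tri y) z<s) ⟩
  threshold y + (m ∸ threshold y)    ≡⟨ m+[n∸m]≡n (≮⇒≥ m≮z) ⟩
  m                                  ∎
  where open ≤-Reasoning

same-band-separates : ∀ {m m' y} → threshold y ≤ m' → m' < m → m ≤ y + m' →
                      bandValue m y ≢ bandValue m' y
same-band-separates {m} {m'} {y} z≤m' m'<m m≤y+m' eq =
  close-residues-differ y (∸-monoˡ-< m'<m z≤m') close (+-cancelˡ-≡ (tri y) _ _ eq)
  where
  z = threshold y
  close : m ∸ z ≤ m' ∸ z + y
  close = begin
    m ∸ z          ≤⟨ ∸-monoˡ-≤ z m≤y+m' ⟩
    y + m' ∸ z     ≡⟨ +-∸-assoc y z≤m' ⟩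
    y + (m' ∸ z)   ≡⟨ +-comm y (m' ∸ z) ⟩
    m' ∸ z + y     ∎
    where open ≤-Reasoning

-- Two band values under the move inequalities differ: equal values would have
-- equal levels y = y', whence u' < u gives m' < m and the previous lemma applies.
bands-separate : ∀ k m y m' y' → threshold y' ≤ m' → m ≤ y' + m' →
                 y' + suc k * m' < y + suc k * m → bandValue m y ≢ bandValue m' y'
bands-separate k m y m' y' z'≤m' m≤y'+m' u'<u eq
  with band-level-injective (m%n<n (m ∸ threshold y) (suc y)) (m%n<n (m' ∸ threshold y') (suc y')) eq
... | refl = same-band-separates z'≤m' m'<m m≤y'+m' eq
  where
  m'<m : m' < m
  m'<m = *-cancelˡ-< (suc k) m' m (+-cancelˡ-< y _ _ u'<u)

g-separates : ∀ k m y m' y' → m ≤ y' + m' → y' + suc k * m' < y + suc k * m →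
              g (suc k) m y ≢ g (suc k) m' y'
g-separates k m y m' y' m≤y'+m' u'<u eq
  with m <? threshold y | m' <? threshold y'
... | yes m<z | yes m'<z' =
  <⇒≢ u'<u (sym (trans (sym (g-low n m y m<z)) (trans eq (g-low n m' y' m'<z'))))
  where n = suc k
... | yes m<z | no m'≮z' =
  <⇒≢ g'<g (sym (trans (sym (g-low n m y m<z)) (trans eq (g-band n m' y' m'≮z'))))
  where
  n = suc k
  g'<g : bandValue m' y' < y + n * m
  g'<g = <-trans (bandValue<m m' y' m'≮z')
           (≤-<-trans (≤-trans (m≤n*m m' n) (m≤n+m _ y')) u'<u)
... | no m≮z | yes m'<z' =
  <⇒≢ g<g' (trans (sym (g-band n m y m≮z)) (trans eq (g-low n m' y' m'<z')))
  where
  n = suc k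
  g<g' : bandValue m y < y' + n * m'
  g<g' = <-≤-trans (bandValue<m m y m≮z) (≤-trans m≤y'+m' (+-monoʳ-≤ y' (m≤n*m m' n)))
... | no m≮z | no m'≮z' = bands-separate k m y m' y' (≮⇒≥ m'≮z') m≤y'+m' u'<u
  (trans (sym (g-band (suc k) m y m≮z)) (trans eq (g-band (suc k) m' y' m'≮z')))

minFin-≤ : ∀ k (f : Fin (suc k) → ℕ) i → minFin k f ≤ f i
minFin-≤ zero    f zero    = ≤-refl
minFin-≤ (suc k) f zero    = m⊓n≤m _ _
minFin-≤ (suc k) f (suc i) = ≤-trans (m⊓n≤n _ _) (minFin-≤ k (λ j → f (suc j)) i)

min*count≤sumFin : ∀ k (f : Fin (suc k) → ℕ) → suc k * minFin k f ≤ sumFin (suc k) f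
min*count≤sumFin zero    f = ≤-refl
min*count≤sumFin (suc k) f = +-mono-≤ (m⊓n≤m (f zero) M)
  (≤-trans (*-monoʳ-≤ (suc k) (m⊓n≤n (f zero) M)) (min*count≤sumFin k (λ j → f (suc j))))
  where M = minFin k (λ j → f (suc j))

min*count+entry≤sumFin : ∀ k (f : Fin (suc k) → ℕ) i → k * minFin k f + f i ≤ sumFin (suc k) f
min*count+entry≤sumFin zero    f zero    = m≤m+n (f zero) 0
min*count+entry≤sumFin (suc k) f zero    = subst (_≤ sumFin (suc (suc k)) f) (+-comm (f zero) _)
  (+-monoʳ-≤ (f zero) (≤-trans (*-monoʳ-≤ (suc k) (m⊓n≤n (f zero) M₁)) (min*count≤sumFin k (λ j → f (suc j)))))
  where M₁ = minFin k (λ j → f (suc j))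
min*count+entry≤sumFin (suc k) f (suc i) = begin
  (M + k * M) + f (suc i)     ≡⟨ +-assoc M (k * M) (f (suc i)) ⟩
  M + (k * M + f (suc i))     ≤⟨ +-mono-≤ (m⊓n≤m (f zero) M₁)
                                  (≤-trans (+-monoˡ-≤ (f (suc i)) (*-monoʳ-≤ k (m⊓n≤n (f zero) M₁)))
                                           (min*count+entry≤sumFin k (λ j → f (suc j)) i)) ⟩
  f zero + sumFin (suc k) (λ j → f (suc j)) ∎
  where
  open ≤-Reasoning
  M  = minFin (suc k) f
  M₁ = minFin k (λ j → f (suc j))

y+n*m≡u : ∀ k (x : Position (suc k)) → yOf k x + suc k * mOf k x ≡ uOf (suc k) x
y+n*m≡u k x = m∸n+n≡m (≤-trans (min*count≤sumFin k (λ j → x (suc j))) (m≤n+m _ (x zero)))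

heap≤y+m : ∀ k (x : Position (suc k)) i → x (suc i) ≤ yOf k x + mOf k x
heap≤y+m k x i = +-cancelˡ-≤ (k * m) _ _ (begin
  k * m + x (suc i)                 ≤⟨ min*count+entry≤sumFin k (λ j → x (suc j)) i ⟩
  sumFin (suc k) (λ j → x (suc j))  ≤⟨ m≤n+m _ (x zero) ⟩
  uOf (suc k) x                     ≡⟨ sym (y+n*m≡u k x) ⟩
  yOf k x + (m + k * m)             ≡⟨ sym (+-assoc (yOf k x) m (k * m)) ⟩
  yOf k x + m + k * m               ≡⟨ +-comm (yOf k x + m) (k * m) ⟩
  k * m + (yOf k x + m)             ∎)
  where
  open ≤-Reasoning
  m = mOf k x

lemma3p6 : (k : ℕ) → 3 ≤ suc k → (m y : ℕ) → (x : Position (suc k)) →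
    mOf k x ≡ m → yOf k x ≡ y →
    ¬ (Σ (Position (suc k)) (λ x' → LegalMove (suc k) x x' ×
         (g (suc k) m y ≡ g (suc k) (mOf k x') (yOf k x'))))
lemma3p6 k _ m y x refl refl (x' , (_ , removes , (i , kept)) , same-g) =
  g-separates k (mOf k x) (yOf k x) (mOf k x') (yOf k x') m≤y'+m' u'<u same-g
  where
  m≤y'+m' : mOf k x ≤ yOf k x' + mOf k x'
  m≤y'+m' = ≤-trans (minFin-≤ k _ i) (subst (_≤ yOf k x' + mOf k x') kept (heap≤y+m k x' i))
  u'<u : yOf k x' + suc k * mOf k x' < yOf k x + suc k * mOf k x
  u'<u = subst₂ _<_ (sym (y+n*m≡u k x')) (sym (y+n*m≡u k x)) removes
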